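{- There is a constant $c>0$ such that for every $m$ there exists a finite set $B \subset \mathbb{R}$ of size $n > m$ such that the sumset $B+B = \{b_1+b_2 : b_1,b_2 \in B\}$ contains a convex set of size at least $cn^2$.
   Context: A finite set $A=\{a_1,\dots,a_N\}$ of real numbers, listed so that $a_1 \le a_2 \le \dots \le a_N$, is called convex if the gaps between consecutive elements are strictly increasing: $a_2-a_1 < a_3-a_2 < \dots < a_N - a_{N-1}$. -}

module Defs where

open import Data.Nat using (ℕ)
open import Data.Integer using (+_)
open import Data.Rational using (ℚ; _/_; _-_; _+_; _<_)
open import Data.List using (List; []; _∷_)
open import Data.List.Relation.Unary.Linked using (Linked)
open import Data.List.Membership.Propositional using (_∈_)
open import Data.Product using (_×_; ∃-syntax)
open import Relation.Binary.PropositionalEquality using (_≡_)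

ℕtoℚ : ℕ → ℚ
ℕtoℚ n = + n / 1

gaps : List ℚ → List ℚ
gaps []           = []
gaps (x ∷ [])     = []
gaps (x ∷ y ∷ r)  = (y - x) ∷ gaps (y ∷ r)

-- A finite set listed in increasing order (strict, since elements of a set are
-- distinct) whose consecutive gaps are strictly increasing.
Convex : List ℚ → Set
Convex A = Linked _<_ A × Linked _<_ (gaps A)

_∈SumSet_ : ℚ → List ℚ → Set
a ∈SumSet B = ∃[ b₁ ] ∃[ b₂ ] (b₁ ∈ B × b₂ ∈ B × a ≡ b₁ + b₂)

module Submission where

-- B consists of X(i) = K(i² + 2(D − e)i) + i² for i ≤ P and Y(j) = H + K(2(D + e)j − j²) + j² for
-- j ≤ Q, where K dominates every lower-order term and H exceeds every X(i). The convex set is read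
-- off along anti-diagonals i + j = s + 2e: there the gaps of X(i) + Y(j) are 2Ks + 4i + O(s + e),
-- growing by 4 per step. Writing D = qs + r, row s runs up to i = s + e + q − r and the next row
-- restarts at i = s + 1 + e − r; since qs ≈ D the jump between them has gap K(2s + 1) + O(e²),
-- which lies strictly between the last gap of row s and the first gap of row s + 1. With
-- s ≈ N … 2N and D ≈ 4N² every row has at least N points, so N·(N − 1) steps fit into rows whose
-- indices stay O(N) while |B| = O(N).

open import Defs
open import Function using (_∘_)
open import Data.Nat as ℕ using (ℕ; zero; suc)
import Data.Nat.Properties as ℕ
open import Data.Integer as ℤ using (ℤ; +_)
import Data.Integer.Properties as ℤ
import Data.Rational as ℚ
import Data.Rational.Properties as ℚ
open import Data.Rational.Literals using (fromℤ)
open import Data.Product using (_×_; _,_)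
open import Data.Sum using (inj₁; inj₂)
open import Relation.Nullary using (yes; no; contradiction)
open import Data.List using (List; _∷_; _++_; length; applyUpTo; last)
import Data.List.Properties as List
open import Data.List.Membership.Propositional.Properties using (∈-++⁺ˡ; ∈-++⁺ʳ; ∈-applyUpTo⁺)
import Data.List.Relation.Unary.All.Properties as All
import Data.List.Relation.Unary.AllPairs as AllPairs
open import Data.List.Relation.Unary.All using (All)
open import Data.List.Relation.Unary.Unique.Propositional using (Unique)
open import Data.Maybe using (just)
open import Data.Maybe.Relation.Binary.Connected using (Connected; just)
open import Data.List.Relation.Unary.Linked using (Linked)
import Data.List.Relation.Unary.Linked.Properties as Linked
open import Data.Integer.Tactic.RingSolver using (solve-∀)
open import Relation.Binary.PropositionalEquality

fromℤ-homo-+ : ∀ i j → fromℤ (i ℤ.+ j) ≡ fromℤ i ℚ.+ fromℤ j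
fromℤ-homo-+ i j = sym (trans (cong₂ (λ a b → (a ℤ.+ b) ℚ./ 1) (ℤ.*-identityʳ i) (ℤ.*-identityʳ j))
                              (ℚ.↥p/↧p≡p (fromℤ (i ℤ.+ j))))

fromℤ-homo‿- : ∀ i → fromℤ (ℤ.- i) ≡ ℚ.- fromℤ i
fromℤ-homo‿- (+ zero)  = refl
fromℤ-homo‿- (+ suc n) = refl
fromℤ-homo‿- ℤ.-[1+ n ] = refl

fromℤ-homo-minus : ∀ i j → fromℤ (i ℤ.- j) ≡ fromℤ i ℚ.- fromℤ j
fromℤ-homo-minus i j = trans (fromℤ-homo-+ i (ℤ.- j)) (cong (fromℤ i ℚ.+_) (fromℤ-homo‿- j))

fromℤ-homo-* : ∀ i j → fromℤ (i ℤ.* j) ≡ fromℤ i ℚ.* fromℤ j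
fromℤ-homo-* i j = sym (ℚ.↥p/↧p≡p (fromℤ (i ℤ.* j)))

fromℤ-mono-< : ∀ {i j} → i ℤ.< j → fromℤ i ℚ.< fromℤ j
fromℤ-mono-< {i} {j} i<j = ℚ.*<* (subst₂ ℤ._<_ (sym (ℤ.*-identityʳ i)) (sym (ℤ.*-identityʳ j)) i<j)

fromℤ-mono-≤ : ∀ {i j} → i ℤ.≤ j → fromℤ i ℚ.≤ fromℤ j
fromℤ-mono-≤ {i} {j} i≤j = ℚ.*≤* (subst₂ ℤ._≤_ (sym (ℤ.*-identityʳ i)) (sym (ℤ.*-identityʳ j)) i≤j)

ℕtoℚ≡fromℤ : ∀ n → ℕtoℚ n ≡ fromℤ (+ n)
ℕtoℚ≡fromℤ n = ℚ.↥p/↧p≡p (fromℤ (+ n))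

last-applyUpTo : ∀ {a} {A : Set a} (f : ℕ → A) n → last (applyUpTo f (suc n)) ≡ just (f n)
last-applyUpTo f zero          = refl
last-applyUpTo f (suc zero)    = refl
last-applyUpTo f (suc (suc n)) = last-applyUpTo (f ∘ suc) (suc n)

pos-∸ : ∀ {m n} → n ℕ.≤ m → + (m ℕ.∸ n) ≡ + m ℤ.- + n
pos-∸ {m} {n} n≤m = trans (sym (ℤ.⊖-≥ n≤m)) (sym (ℤ.m-n≡m⊖n m n))

0<j-i⇒i<j : ∀ {i j} → ℤ.0ℤ ℤ.< j ℤ.- i → i ℤ.< j
0<j-i⇒i<j {i} {j} 0<j-i = subst₂ ℤ._<_ (ℤ.+-identityʳ i) (i+[j-i]≡j i j) (ℤ.+-monoʳ-< i 0<j-i)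
  where
  i+[j-i]≡j : ∀ i j → i ℤ.+ (j ℤ.- i) ≡ j
  i+[j-i]≡j = solve-∀

Δ : (ℕ → ℤ) → ℕ → ℤ
Δ f k = f (suc k) ℤ.- f k

gaps-applyUpTo : ∀ (f : ℕ → ℚ.ℚ) n → gaps (applyUpTo f (suc n)) ≡ applyUpTo (λ k → f (suc k) ℚ.- f k) n
gaps-applyUpTo f zero    = refl
gaps-applyUpTo f (suc n) = cong (f 1 ℚ.- f 0 ∷_) (gaps-applyUpTo (f ∘ suc) n)

convex-applyUpTo : ∀ (f : ℕ → ℤ) n → ℤ.0ℤ ℤ.< Δ f 0 →
                   (∀ {k} → suc k ℕ.< n → Δ f k ℤ.< Δ f (suc k)) →
                   Convex (applyUpTo (fromℤ ∘ f) (suc n))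
convex-applyUpTo f n 0<Δ₀ Δ-increasing =
  Linked.applyUpTo⁺₁ (fromℤ ∘ f) (suc n)
    (λ {k} k<n → fromℤ-mono-< (0<j-i⇒i<j {f k} (0<Δ k (ℕ.≤-pred k<n)))) ,
  subst (Linked ℚ._<_) (sym (gaps-applyUpTo (fromℤ ∘ f) n))
    (Linked.applyUpTo⁺₁ _ n (λ {k} k+1<n →
      subst₂ ℚ._<_ (fromℤ-homo-minus (f (suc k)) (f k)) (fromℤ-homo-minus (f (suc (suc k))) (f (suc k)))
        (fromℤ-mono-< (Δ-increasing k+1<n))))
  where
  0<Δ : ∀ k → k ℕ.< n → ℤ.0ℤ ℤ.< Δ f k
  0<Δ zero    _   = 0<Δ₀
  0<Δ (suc k) k<n = ℤ.<-trans (0<Δ k (ℕ.<-trans (ℕ.n<1+n k) k<n)) (Δ-increasing k<n)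

x²≤ky⇒cx²≤y : ∀ c .{{_ : ℚ.NonNegative c}} k x y → c ℚ.* ℕtoℚ k ≡ ℚ.1ℚ →
               x ℕ.* x ℕ.≤ k ℕ.* y → c ℚ.* (ℕtoℚ x ℚ.* ℕtoℚ x) ℚ.≤ ℕtoℚ y
x²≤ky⇒cx²≤y c k x y ck≡1 x*x≤k*y
  rewrite ℕtoℚ≡fromℤ x | ℕtoℚ≡fromℤ y | ℕtoℚ≡fromℤ k = begin
    c ℚ.* (fromℤ (+ x) ℚ.* fromℤ (+ x))   ≡⟨ cong (c ℚ.*_) (sym (fromℤ-homo-* (+ x) (+ x))) ⟩
    c ℚ.* fromℤ (+ x ℤ.* + x)             ≤⟨ ℚ.*-monoˡ-≤-nonNeg c (fromℤ-mono-≤ x²≤ky) ⟩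
    c ℚ.* fromℤ (+ k ℤ.* + y)             ≡⟨ cong (c ℚ.*_) (fromℤ-homo-* (+ k) (+ y)) ⟩
    c ℚ.* (fromℤ (+ k) ℚ.* fromℤ (+ y))   ≡⟨ sym (ℚ.*-assoc c _ _) ⟩
    c ℚ.* fromℤ (+ k) ℚ.* fromℤ (+ y)     ≡⟨ cong (ℚ._* fromℤ (+ y)) ck≡1 ⟩
    ℚ.1ℚ ℚ.* fromℤ (+ y)                  ≡⟨ ℚ.*-identityˡ _ ⟩
    fromℤ (+ y)                           ∎
  where
  open ℚ.≤-Reasoning
  x²≤ky : + x ℤ.* + x ℤ.≤ + k ℤ.* + y
  x²≤ky = subst₂ ℤ._≤_ (ℤ.pos-* x x) (ℤ.pos-* k y) (ℤ.+≤+ x*x≤k*y)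

-- The integer ring solver treats a cast + n as opaque, so an inequality x < y between integer
-- polynomials in natural variables is certified by natural polynomials l < r with x + r = y + l:
-- the equation is a ring identity and l < r is proved by monotonicity in ℕ.
module NatPolynomial where

  open import Data.Fin using (Fin)
  open import Data.Vec using (Vec; lookup)

  infixl 6 _:+_
  infixl 7 _:*_

  data Poly (n : ℕ) : Set where
    con       : ℕ → Poly n
    var       : Fin n → Poly n
    _:+_ _:*_ : Poly n → Poly n → Poly n

  ⟦_⟧ : ∀ {n} → Poly n → Vec ℕ n → ℕ
  ⟦ con c  ⟧ ρ = c
  ⟦ var x  ⟧ ρ = lookup ρ x
  ⟦ p :+ q ⟧ ρ = ⟦ p ⟧ ρ ℕ.+ ⟦ q ⟧ ρ
  ⟦ p :* q ⟧ ρ = ⟦ p ⟧ ρ ℕ.* ⟦ q ⟧ ρ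

  ⟦_⟧ℤ : ∀ {n} → Poly n → Vec ℕ n → ℤ
  ⟦ con c  ⟧ℤ ρ = + c
  ⟦ var x  ⟧ℤ ρ = + lookup ρ x
  ⟦ p :+ q ⟧ℤ ρ = ⟦ p ⟧ℤ ρ ℤ.+ ⟦ q ⟧ℤ ρ
  ⟦ p :* q ⟧ℤ ρ = ⟦ p ⟧ℤ ρ ℤ.* ⟦ q ⟧ℤ ρ

  ⟦⟧-cast : ∀ {n} (p : Poly n) ρ → + ⟦ p ⟧ ρ ≡ ⟦ p ⟧ℤ ρ
  ⟦⟧-cast (con c)  ρ = refl
  ⟦⟧-cast (var x)  ρ = refl
  ⟦⟧-cast (p :+ q) ρ = trans (ℤ.pos-+ (⟦ p ⟧ ρ) (⟦ q ⟧ ρ)) (cong₂ ℤ._+_ (⟦⟧-cast p ρ) (⟦⟧-cast q ρ))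
  ⟦⟧-cast (p :* q) ρ = trans (ℤ.pos-* (⟦ p ⟧ ρ) (⟦ q ⟧ ρ)) (cong₂ ℤ._*_ (⟦⟧-cast p ρ) (⟦⟧-cast q ρ))

  <-from-balance : ∀ {n} {x y : ℤ} (l r : Poly n) ρ →
                   x ℤ.+ ⟦ r ⟧ℤ ρ ≡ y ℤ.+ ⟦ l ⟧ℤ ρ → ⟦ l ⟧ ρ ℕ.< ⟦ r ⟧ ρ → x ℤ.< y
  <-from-balance {x = x} {y} l r ρ balance l<r =
    subst₂ ℤ._<_ (+-cancel x lℤ) (+-cancel y lℤ) (ℤ.+-monoˡ-< (ℤ.- lℤ) x+l<y+l)
    where
    lℤ : ℤ
    lℤ = ⟦ l ⟧ℤ ρ
    x+l<y+l : x ℤ.+ lℤ ℤ.< y ℤ.+ lℤ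
    x+l<y+l = subst (x ℤ.+ lℤ ℤ.<_) balance
      (ℤ.+-monoʳ-< x (subst₂ ℤ._<_ (⟦⟧-cast l ρ) (⟦⟧-cast r ρ) (ℤ.+<+ l<r)))
    +-cancel : ∀ i j → i ℤ.+ j ℤ.- j ≡ i
    +-cancel = solve-∀

module Construction
  (M e D K : ℕ)
  (2N≤e : suc M ℕ.+ suc M ℕ.≤ e)
  (e≤D : e ℕ.≤ D)
  (K-dominant : 4 ℕ.* (e ℕ.* e) ℕ.+ 4 ℕ.* e ℕ.< K)
  (quotient-large : ∀ d → d ℕ.≤ suc M → suc M ℕ.+ suc M ℕ.≤ D ℕ./ suc (d ℕ.+ M))
  (quotient-small : ∀ d → D ℕ./ suc (d ℕ.+ M) ℕ.≤ e)
  where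

  open import Data.Nat using (_≤_; _<_; z≤n; s≤s)
  open import Data.Integer using (_+_; _-_; _*_)
  open import Data.Nat.DivMod using (m≡m%n+[m/n]*n; m%n<n)
  open import Data.Nat.Tactic.RingSolver using () renaming (solve-∀ to solve-∀ℕ)
  open import Data.Fin using (#_)
  open import Data.Vec using ([]; _∷_)
  open NatPolynomial

  N : ℕ
  N = suc M

  -- Row d lies on the anti-diagonal i + j = σ d + 2e.
  σ q r : ℕ → ℕ
  σ d = suc (d ℕ.+ M)
  q d = D ℕ./ σ d
  r d = D ℕ.% σ d

  D-divmod : ∀ d → + D ≡ + r d + + q d * + σ d
  D-divmod d = trans (cong +_ (m≡m%n+[m/n]*n D (σ d))) (cong (λ x → + r d + x) (ℤ.pos-* (q d) (σ d)))

  r<σ : ∀ d → r d < σ d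
  r<σ d = m%n<n D (σ d)

  σ≤N+N : ∀ {d} → d ≤ suc M → σ d ≤ N ℕ.+ N
  σ≤N+N {d} d≤N = ℕ.≤-trans (s≤s (ℕ.+-monoˡ-≤ M d≤N)) (ℕ.≤-reflexive (sym (ℕ.+-suc N M)))

  σ≤e : ∀ {d} → d ≤ M → σ d ≤ e
  σ≤e d≤M = ℕ.≤-trans (σ≤N+N (ℕ.m≤n⇒m≤1+n d≤M)) 2N≤e

  r≤e : ∀ {d} → d ≤ M → r d ≤ e
  r≤e d≤M = ℕ.≤-trans (ℕ.<⇒≤ (r<σ _)) (σ≤e d≤M)

  N≤q : ∀ {d} → d ≤ M → N ≤ q d
  N≤q d≤M = ℕ.≤-trans (ℕ.m≤m+n N N) (quotient-large _ (ℕ.m≤n⇒m≤1+n d≤M))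

  r<q : ∀ {d} → d ≤ suc M → r d < q d
  r<q {d} d≤N = ℕ.<-≤-trans (r<σ d) (ℕ.≤-trans (σ≤N+N d≤N) (quotient-large d d≤N))

  rowEnd nextRowStart : ℕ → ℕ
  rowEnd d = σ d ℕ.+ e ℕ.+ q d ℕ.∸ r d
  nextRowStart d = suc (σ d) ℕ.+ e ℕ.∸ r d

  rowEnd-ℤ : ∀ d → + rowEnd d ≡ + σ d + + e + + q d - + r d
  rowEnd-ℤ d = pos-∸ (ℕ.≤-trans (ℕ.<⇒≤ (r<σ d)) (ℕ.≤-trans (ℕ.m≤m+n (σ d) e) (ℕ.m≤m+n _ (q d))))

  nextRowStart-ℤ : ∀ d → + nextRowStart d ≡ + 1 + + σ d + + e - + r d
  nextRowStart-ℤ d = pos-∸ (ℕ.≤-trans (ℕ.<⇒≤ (r<σ d)) (ℕ.≤-trans (ℕ.n≤1+n (σ d)) (ℕ.m≤m+n _ e)))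

  nextRowStart+q≡1+rowEnd : ∀ d → nextRowStart d ℕ.+ q d ≡ suc (rowEnd d)
  nextRowStart+q≡1+rowEnd d = ℤ.+-injective (begin
    + nextRowStart d + + q d                   ≡⟨ cong (_+ + q d) (nextRowStart-ℤ d) ⟩
    + 1 + + σ d + + e - + r d + + q d          ≡⟨ identity (+ σ d) (+ e) (+ q d) (+ r d) ⟩
    + 1 + (+ σ d + + e + + q d - + r d)        ≡⟨ cong ℤ.suc (sym (rowEnd-ℤ d)) ⟩
    + suc (rowEnd d)                           ∎)
    where
    open ≡-Reasoning
    identity : ∀ s e q r → + 1 + s + e - r + q ≡ + 1 + (s + e + q - r)
    identity = solve-∀

  e<nextRowStart : ∀ d → e < nextRowStart d
  e<nextRowStart d = ℕ.m+n≤o⇒m≤o∸n (suc e) (s≤s (ℕ.≤-trans (ℕ.+-monoʳ-≤ e (ℕ.<⇒≤ (r<σ d)))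
                                                            (ℕ.≤-reflexive (ℕ.+-comm e (σ d)))))

  nextRowStart<rowEnd : ∀ {d} → d ≤ M → nextRowStart d < rowEnd (suc d)
  nextRowStart<rowEnd {d} d≤M = ℕ.≤-<-trans (ℕ.m∸n≤m _ (r d))
    (ℕ.m+n≤o⇒m≤o∸n (suc (σ (suc d) ℕ.+ e))
      (ℕ.≤-trans (ℕ.≤-reflexive (sym (ℕ.+-suc (σ (suc d) ℕ.+ e) (r (suc d)))))
                 (ℕ.+-monoʳ-≤ (σ (suc d) ℕ.+ e) (r<q (s≤s d≤M)))))

  rowEnd≤σ+e+q : ∀ d → rowEnd d ≤ σ d ℕ.+ e ℕ.+ q d
  rowEnd≤σ+e+q d = ℕ.m∸n≤m _ (r d)

  P Q : ℕ
  P = N ℕ.+ N ℕ.+ e ℕ.+ e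
  Q = N ℕ.+ N ℕ.+ e

  X : ℤ → ℤ
  X x = + K * (x * x + + 2 * (+ D - + e) * x) + x * x

  H : ℤ
  H = ℤ.suc (X (+ P))

  Y : ℤ → ℤ
  Y y = H + + K * (+ 2 * (+ D + + e) * y - y * y) + y * y

  V : ℤ → ℤ → ℤ
  V s i = X i + Y (s + (+ e + + e) - i)

  G : ℤ → ℤ → ℤ
  G s i = + 2 * + K * s + + 4 * i + + 2 - + 2 * s - + 4 * + e

  T : ℤ → ℤ → ℤ → ℤ
  T s q r = + K * (+ 2 * s + + 1) + + 2 * s + + 2 * + e - + 2 * r
            + + 4 * q * r - + 2 * q * q - + 2 * q * s + + 1

  V-suc : ∀ s i → V s (+ 1 + i) - V s i ≡ G s i
  V-suc = identity (+ K) (+ e) (+ D) H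
    where
    identity : ∀ K e D H s i →
      let X : ℤ → ℤ
          X x = K * (x * x + + 2 * (D - e) * x) + x * x
          V : ℤ → ℤ → ℤ
          V t j = X j + (H + K * (+ 2 * (D + e) * (t + (e + e) - j) - (t + (e + e) - j) * (t + (e + e) - j))
                         + (t + (e + e) - j) * (t + (e + e) - j))
      in V s (+ 1 + i) - V s i ≡ + 2 * K * s + + 4 * i + + 2 - + 2 * s - + 4 * e
    identity = solve-∀

  V-transition : ∀ s q r → + D ≡ r + q * s →
                 V (+ 1 + s) (+ 1 + s + + e - r) - V s (s + + e + q - r) ≡ T s q r
  V-transition s q r D≡r+qs = begin
    V (+ 1 + s) (+ 1 + s + + e - r) - V s (s + + e + q - r)   ≡⟨ identity (+ K) (+ e) (+ D) H s q r ⟩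
    T s q r + + 2 * + K * (+ D - (r + q * s))                 ≡⟨ cong (λ x → T s q r + + 2 * + K * (x - (r + q * s))) D≡r+qs ⟩
    T s q r + + 2 * + K * ((r + q * s) - (r + q * s))         ≡⟨ cancel (T s q r) (+ K) (r + q * s) ⟩
    T s q r                                                   ∎
    where
    open ≡-Reasoning
    -- The left-hand side is linear in D with slope 2K, and equals T s q r when D = r + q s.
    identity : ∀ K e D H s q r →
      let X : ℤ → ℤ
          X x = K * (x * x + + 2 * (D - e) * x) + x * x
          V : ℤ → ℤ → ℤ
          V t j = X j + (H + K * (+ 2 * (D + e) * (t + (e + e) - j) - (t + (e + e) - j) * (t + (e + e) - j))
                         + (t + (e + e) - j) * (t + (e + e) - j))
      in V (+ 1 + s) (+ 1 + s + e - r) - V s (s + e + q - r)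
         ≡ K * (+ 2 * s + + 1) + + 2 * s + + 2 * e - + 2 * r + + 4 * q * r - + 2 * q * q - + 2 * q * s + + 1
           + + 2 * K * (D - (r + q * s))
    identity = solve-∀
    cancel : ∀ t K x → t + + 2 * K * (x - x) ≡ t
    cancel = solve-∀

  1≤K : 1 ≤ K
  1≤K = ℕ.≤-trans (s≤s z≤n) K-dominant

  2qq+2qs+4q<K : ∀ {q s} → q ≤ e → s ≤ e → 2 ℕ.* q ℕ.* q ℕ.+ 2 ℕ.* q ℕ.* s ℕ.+ 4 ℕ.* q < K
  2qq+2qs+4q<K {q} {s} q≤e s≤e = ℕ.≤-<-trans (begin
    2 ℕ.* q ℕ.* q ℕ.+ 2 ℕ.* q ℕ.* s ℕ.+ 4 ℕ.* q  ≤⟨ ℕ.+-mono-≤ (ℕ.+-mono-≤ (ℕ.*-mono-≤ (ℕ.*-monoʳ-≤ 2 q≤e) q≤e)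
                                                       (ℕ.*-mono-≤ (ℕ.*-monoʳ-≤ 2 q≤e) s≤e)) (ℕ.*-monoʳ-≤ 4 q≤e) ⟩
    2 ℕ.* e ℕ.* e ℕ.+ 2 ℕ.* e ℕ.* e ℕ.+ 4 ℕ.* e  ≡⟨ identity e ⟩
    4 ℕ.* (e ℕ.* e) ℕ.+ 4 ℕ.* e                  ∎) K-dominant
    where
    open ℕ.≤-Reasoning
    identity : ∀ e → 2 ℕ.* e ℕ.* e ℕ.+ 2 ℕ.* e ℕ.* e ℕ.+ 4 ℕ.* e ≡ 4 ℕ.* (e ℕ.* e) ℕ.+ 4 ℕ.* e
    identity = solve-∀ℕ

  2r+2e+4qr<K : ∀ {q r} → q ≤ e → r ≤ e → 2 ℕ.* r ℕ.+ 2 ℕ.* e ℕ.+ 4 ℕ.* q ℕ.* r < K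
  2r+2e+4qr<K {q} {r} q≤e r≤e = ℕ.≤-<-trans (begin
    2 ℕ.* r ℕ.+ 2 ℕ.* e ℕ.+ 4 ℕ.* q ℕ.* r  ≤⟨ ℕ.+-mono-≤ (ℕ.+-monoˡ-≤ (2 ℕ.* e) (ℕ.*-monoʳ-≤ 2 r≤e))
                                                 (ℕ.*-mono-≤ (ℕ.*-monoʳ-≤ 4 q≤e) r≤e) ⟩
    2 ℕ.* e ℕ.+ 2 ℕ.* e ℕ.+ 4 ℕ.* e ℕ.* e  ≡⟨ identity e ⟩
    4 ℕ.* (e ℕ.* e) ℕ.+ 4 ℕ.* e            ∎) K-dominant
    where
    open ℕ.≤-Reasoning
    identity : ∀ e → 2 ℕ.* e ℕ.+ 2 ℕ.* e ℕ.+ 4 ℕ.* e ℕ.* e ≡ 4 ℕ.* (e ℕ.* e) ℕ.+ 4 ℕ.* e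
    identity = solve-∀ℕ

  G-suc : ∀ s i → G s i ℤ.< G s (+ 1 + i)
  G-suc s i = <-from-balance (con 0) (con 4) [] (identity (+ K) (+ e) s i) (s≤s z≤n)
    where
    identity : ∀ K e s i →
      let G : ℤ → ℤ → ℤ
          G s i = + 2 * K * s + + 4 * i + + 2 - + 2 * s - + 4 * e
      in G s i + + 4 ≡ G s (+ 1 + i) + + 0
    identity = solve-∀

  G-positive : ∀ s i → e < i → ℤ.0ℤ ℤ.< G (+ s) (+ i)
  G-positive s i e<i =
    <-from-balance (con 2 :* sᵥ :+ con 4 :* eᵥ) (con 2 :* Kᵥ :* sᵥ :+ con 4 :* iᵥ :+ con 2)
      (K ∷ e ∷ s ∷ i ∷ []) (identity (+ K) (+ e) (+ s) (+ i))
      (ℕ.<-≤-trans (ℕ.+-mono-≤-< (ℕ.*-monoˡ-≤ s (ℕ.*-monoʳ-≤ 2 1≤K)) (ℕ.*-monoʳ-< 4 e<i))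
                   (ℕ.m≤m+n _ 2))
    where
    Kᵥ eᵥ sᵥ iᵥ : Poly 4
    Kᵥ = var (# 0); eᵥ = var (# 1); sᵥ = var (# 2); iᵥ = var (# 3)
    identity : ∀ K e s i →
      ℤ.0ℤ + (+ 2 * K * s + + 4 * i + + 2) ≡ (+ 2 * K * s + + 4 * i + + 2 - + 2 * s - + 4 * e) + (+ 2 * s + + 4 * e)
    identity = solve-∀

  G<T : ∀ q r s → q ≤ e → s ≤ e → G (+ s) (+ s + + e + + q - + r - + 1) ℤ.< T (+ s) (+ q) (+ r)
  G<T q r s q≤e s≤e =
    <-from-balance (con 2 :* qᵥ :* qᵥ :+ con 2 :* qᵥ :* sᵥ :+ con 4 :* qᵥ)
                   (Kᵥ :+ con 2 :* eᵥ :+ con 2 :* rᵥ :+ con 4 :* qᵥ :* rᵥ :+ con 3)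
      (K ∷ e ∷ q ∷ r ∷ s ∷ []) (identity (+ K) (+ e) (+ q) (+ r) (+ s))
      (ℕ.<-≤-trans (2qq+2qs+4q<K q≤e s≤e) (ℕ.≤-trans (ℕ.m≤m+n K _)
        (ℕ.≤-trans (ℕ.m≤m+n _ _) (ℕ.≤-trans (ℕ.m≤m+n _ _) (ℕ.m≤m+n _ _)))))
    where
    Kᵥ eᵥ qᵥ rᵥ sᵥ : Poly 5
    Kᵥ = var (# 0); eᵥ = var (# 1); qᵥ = var (# 2); rᵥ = var (# 3); sᵥ = var (# 4)
    identity : ∀ K e q r s →
      let G : ℤ → ℤ → ℤ
          G s i = + 2 * K * s + + 4 * i + + 2 - + 2 * s - + 4 * e
          T : ℤ
          T = K * (+ 2 * s + + 1) + + 2 * s + + 2 * e - + 2 * r + + 4 * q * r - + 2 * q * q - + 2 * q * s + + 1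
      in G s (s + e + q - r - + 1) + (K + + 2 * e + + 2 * r + + 4 * q * r + + 3)
         ≡ T + (+ 2 * q * q + + 2 * q * s + + 4 * q)
    identity = solve-∀

  T<G : ∀ q r s → q ≤ e → r ≤ e → T (+ s) (+ q) (+ r) ℤ.< G (+ 1 + + s) (+ 1 + + s + + e - + r)
  T<G q r s q≤e r≤e =
    <-from-balance (con 2 :* rᵥ :+ con 2 :* eᵥ :+ con 4 :* qᵥ :* rᵥ)
                   (Kᵥ :+ con 3 :+ con 2 :* qᵥ :* qᵥ :+ con 2 :* qᵥ :* sᵥ)
      (K ∷ e ∷ q ∷ r ∷ s ∷ []) (identity (+ K) (+ e) (+ q) (+ r) (+ s))
      (ℕ.<-≤-trans (2r+2e+4qr<K q≤e r≤e) (ℕ.≤-trans (ℕ.m≤m+n K _)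
        (ℕ.≤-trans (ℕ.m≤m+n _ _) (ℕ.m≤m+n _ _))))
    where
    Kᵥ eᵥ qᵥ rᵥ sᵥ : Poly 5
    Kᵥ = var (# 0); eᵥ = var (# 1); qᵥ = var (# 2); rᵥ = var (# 3); sᵥ = var (# 4)
    identity : ∀ K e q r s →
      let G : ℤ → ℤ → ℤ
          G s i = + 2 * K * s + + 4 * i + + 2 - + 2 * s - + 4 * e
          T : ℤ
          T = K * (+ 2 * s + + 1) + + 2 * s + + 2 * e - + 2 * r + + 4 * q * r - + 2 * q * q - + 2 * q * s + + 1
      in T + (K + + 3 + + 2 * q * q + + 2 * q * s)
         ≡ G (+ 1 + s) (+ 1 + s + e - r) + (+ 2 * r + + 2 * e + + 4 * q * r)
    identity = solve-∀

  State : Set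
  State = ℕ × ℕ

  value : State → ℤ
  value (d , i) = V (+ σ d) (+ i)

  step : State → State
  step (d , i) with i ℕ.<? rowEnd d
  ... | yes _ = d , suc i
  ... | no  _ = suc d , nextRowStart d

  step-inRow : ∀ {d i} → i < rowEnd d → step (d , i) ≡ (d , suc i)
  step-inRow {d} {i} i<end with i ℕ.<? rowEnd d
  ... | yes _     = refl
  ... | no  i≮end = contradiction i<end i≮end

  step-rowEnd : ∀ d → step (d , rowEnd d) ≡ (suc d , nextRowStart d)
  step-rowEnd d with rowEnd d ℕ.<? rowEnd d
  ... | yes end<end = contradiction end<end (ℕ.<-irrefl refl)
  ... | no  _       = refl

  gap : State → ℤ
  gap s = value (step s) - value s

  gap-inRow : ∀ {d i} → i < rowEnd d → gap (d , i) ≡ G (+ σ d) (+ i)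
  gap-inRow {d} {i} i<end =
    trans (cong (λ t → value t - value (d , i)) (step-inRow i<end)) (V-suc (+ σ d) (+ i))

  gap-rowEnd : ∀ d → gap (d , rowEnd d) ≡ T (+ σ d) (+ q d) (+ r d)
  gap-rowEnd d = begin
    value (step (d , rowEnd d)) - value (d , rowEnd d)
      ≡⟨ cong (λ t → value t - value (d , rowEnd d)) (step-rowEnd d) ⟩
    V (+ 1 + + σ d) (+ nextRowStart d) - V (+ σ d) (+ rowEnd d)
      ≡⟨ cong₂ (λ a b → V (+ 1 + + σ d) a - V (+ σ d) b) (nextRowStart-ℤ d) (rowEnd-ℤ d) ⟩
    V (+ 1 + + σ d) (+ 1 + + σ d + + e - + r d) - V (+ σ d) (+ σ d + + e + + q d - + r d)
      ≡⟨ V-transition (+ σ d) (+ q d) (+ r d) (D-divmod d) ⟩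
    T (+ σ d) (+ q d) (+ r d) ∎
    where open ≡-Reasoning

  G<T-atRowEnd : ∀ {d i} → d ≤ M → suc i ≡ rowEnd d → G (+ σ d) (+ i) ℤ.< T (+ σ d) (+ q d) (+ r d)
  G<T-atRowEnd {d} {i} d≤M i+1≡end =
    subst (λ x → G (+ σ d) x ℤ.< T (+ σ d) (+ q d) (+ r d)) (sym i≡end-1)
          (G<T (q d) (r d) (σ d) (quotient-small d) (σ≤e d≤M))
    where
    i≡end-1 : + i ≡ + σ d + + e + + q d - + r d - + 1
    i≡end-1 = trans (sym (identity (+ i))) (cong (_- + 1) (trans (cong +_ i+1≡end) (rowEnd-ℤ d)))
      where
      identity : ∀ x → + 1 + x - + 1 ≡ x
      identity = solve-∀

  T<G-atNextRow : ∀ {d} → d ≤ M → T (+ σ d) (+ q d) (+ r d) ℤ.< G (+ σ (suc d)) (+ nextRowStart d)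
  T<G-atNextRow {d} d≤M =
    subst (λ x → T (+ σ d) (+ q d) (+ r d) ℤ.< G (+ 1 + + σ d) x) (sym (nextRowStart-ℤ d))
          (T<G (q d) (r d) (σ d) (quotient-small d) (r≤e d≤M))

  gap-increasing-atRowEnd : ∀ {d} → d ≤ M → gap (d , rowEnd d) ℤ.< gap (step (d , rowEnd d))
  gap-increasing-atRowEnd {d} d≤M = subst₂ ℤ._<_ (sym (gap-rowEnd d))
    (sym (trans (cong gap (step-rowEnd d)) (gap-inRow (nextRowStart<rowEnd d≤M)))) (T<G-atNextRow d≤M)

  gap-increasing-beforeRowEnd : ∀ {d i} → d ≤ M → suc i ≡ rowEnd d → gap (d , i) ℤ.< gap (step (d , i))
  gap-increasing-beforeRowEnd {d} {i} d≤M i+1≡end =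
    subst₂ ℤ._<_ (sym (gap-inRow i<end)) (sym gap-step≡T) (G<T-atRowEnd d≤M i+1≡end)
    where
    i<end : i < rowEnd d
    i<end = ℕ.≤-reflexive i+1≡end
    gap-step≡T : gap (step (d , i)) ≡ T (+ σ d) (+ q d) (+ r d)
    gap-step≡T = trans (cong gap (step-inRow i<end)) (trans (cong (λ j → gap (d , j)) i+1≡end) (gap-rowEnd d))

  gap-increasing-inRow : ∀ {d i} → suc i < rowEnd d → gap (d , i) ℤ.< gap (step (d , i))
  gap-increasing-inRow {d} {i} i+1<end =
    subst₂ ℤ._<_ (sym (gap-inRow i<end)) (sym gap-step≡G) (G-suc (+ σ d) (+ i))
    where
    i<end : i < rowEnd d
    i<end = ℕ.<⇒≤ i+1<end
    gap-step≡G : gap (step (d , i)) ≡ G (+ σ d) (+ suc i)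
    gap-step≡G = trans (cong gap (step-inRow i<end)) (gap-inRow i+1<end)

  gap-increasing : ∀ {d i} → d ≤ M → i ≤ rowEnd d → gap (d , i) ℤ.< gap (step (d , i))
  gap-increasing {d} {i} d≤M i≤end with ℕ.m≤n⇒m<n∨m≡n i≤end
  ... | inj₂ i≡end = subst (λ j → gap (d , j) ℤ.< gap (step (d , j))) (sym i≡end) (gap-increasing-atRowEnd d≤M)
  ... | inj₁ i<end with ℕ.m≤n⇒m<n∨m≡n i<end
  ...   | inj₁ i+1<end = gap-increasing-inRow i+1<end
  ...   | inj₂ i+1≡end = gap-increasing-beforeRowEnd d≤M i+1≡end

  -- After k steps the potential d·N + i has grown by at most k, since each row has at least
  -- N points; this keeps the row index d at most M.
  Invariant : ℕ → State → Set
  Invariant k (d , i) = e < i × i ≤ rowEnd d × d ℕ.* N ℕ.+ i ≤ k ℕ.+ (N ℕ.+ e)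

  row-bound : ∀ {k d i} → Invariant k (d , i) → k ≤ M ℕ.* N → d ≤ M
  row-bound {k} {d} {i} (e<i , _ , potential) k≤MN =
    ℕ.≤-pred (ℕ.*-cancelʳ-< N d (suc M) (ℕ.+-cancelʳ-≤ e (suc (d ℕ.* N)) (suc M ℕ.* N) (begin
      suc (d ℕ.* N) ℕ.+ e      ≡⟨ sym (ℕ.+-suc (d ℕ.* N) e) ⟩
      d ℕ.* N ℕ.+ suc e        ≤⟨ ℕ.+-monoʳ-≤ (d ℕ.* N) e<i ⟩
      d ℕ.* N ℕ.+ i            ≤⟨ potential ⟩
      k ℕ.+ (N ℕ.+ e)          ≤⟨ ℕ.+-monoˡ-≤ (N ℕ.+ e) k≤MN ⟩
      M ℕ.* N ℕ.+ (N ℕ.+ e)    ≡⟨ identity (M ℕ.* N) N e ⟩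
      suc M ℕ.* N ℕ.+ e        ∎)))
    where
    open ℕ.≤-Reasoning
    identity : ∀ x N e → x ℕ.+ (N ℕ.+ e) ≡ N ℕ.+ x ℕ.+ e
    identity = solve-∀ℕ

  Invariant-step : ∀ {k d i} → Invariant k (d , i) → k ≤ M ℕ.* N → Invariant (suc k) (step (d , i))
  Invariant-step {k} {d} {i} inv@(e<i , i≤end , potential) k≤MN with ℕ.m≤n⇒m<n∨m≡n i≤end
  ... | inj₁ i<end = subst (Invariant (suc k)) (sym (step-inRow i<end))
    (ℕ.m<n⇒m<1+n e<i , i<end , subst (ℕ._≤ suc k ℕ.+ (N ℕ.+ e)) (sym (ℕ.+-suc (d ℕ.* N) i)) (s≤s potential))
  ... | inj₂ i≡end = subst (Invariant (suc k)) (sym (trans (cong (λ j → step (d , j)) i≡end) (step-rowEnd d)))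
    (e<nextRowStart d , ℕ.<⇒≤ (nextRowStart<rowEnd d≤M) , next-potential)
    where
    open ℕ.≤-Reasoning
    d≤M : d ≤ M
    d≤M = row-bound inv k≤MN
    identity : ∀ x y z → x ℕ.+ y ℕ.+ z ≡ y ℕ.+ (z ℕ.+ x)
    identity = solve-∀ℕ
    next-potential : suc d ℕ.* N ℕ.+ nextRowStart d ≤ suc k ℕ.+ (N ℕ.+ e)
    next-potential = begin
      N ℕ.+ d ℕ.* N ℕ.+ nextRowStart d      ≤⟨ ℕ.+-monoˡ-≤ (nextRowStart d) (ℕ.+-monoˡ-≤ (d ℕ.* N) (N≤q d≤M)) ⟩
      q d ℕ.+ d ℕ.* N ℕ.+ nextRowStart d    ≡⟨ identity (q d) (d ℕ.* N) (nextRowStart d) ⟩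
      d ℕ.* N ℕ.+ (nextRowStart d ℕ.+ q d)  ≡⟨ cong (d ℕ.* N ℕ.+_) (nextRowStart+q≡1+rowEnd d) ⟩
      d ℕ.* N ℕ.+ suc (rowEnd d)            ≡⟨ ℕ.+-suc (d ℕ.* N) (rowEnd d) ⟩
      suc (d ℕ.* N ℕ.+ rowEnd d)            ≤⟨ s≤s (subst (λ j → d ℕ.* N ℕ.+ j ≤ k ℕ.+ (N ℕ.+ e)) i≡end potential) ⟩
      suc k ℕ.+ (N ℕ.+ e)                   ∎

  walk : ℕ → State
  walk zero    = 0 , N ℕ.+ e
  walk (suc k) = step (walk k)

  N+e<rowEnd₀ : N ℕ.+ e < rowEnd 0
  N+e<rowEnd₀ = ℕ.m+n≤o⇒m≤o∸n (suc (N ℕ.+ e))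
    (ℕ.≤-trans (ℕ.≤-reflexive (sym (ℕ.+-suc (N ℕ.+ e) (r 0)))) (ℕ.+-monoʳ-≤ (N ℕ.+ e) (r<q z≤n)))

  walk-invariant : ∀ k → k ≤ M ℕ.* N → Invariant k (walk k)
  walk-invariant zero    _    = s≤s (ℕ.m≤n+m e M) , ℕ.<⇒≤ N+e<rowEnd₀ , ℕ.≤-refl
  walk-invariant (suc k) k<MN = Invariant-step (walk-invariant k (ℕ.<⇒≤ k<MN)) (ℕ.<⇒≤ k<MN)

  first-gap-positive : ℤ.0ℤ ℤ.< gap (walk 0)
  first-gap-positive =
    subst (ℤ.0ℤ ℤ.<_) (sym (gap-inRow N+e<rowEnd₀)) (G-positive (σ 0) (N ℕ.+ e) (s≤s (ℕ.m≤n+m e M)))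

  walk-gap-increasing : ∀ k → k ≤ M ℕ.* N → gap (walk k) ℤ.< gap (walk (suc k))
  walk-gap-increasing k k≤MN with walk-invariant k k≤MN
  ... | inv@(_ , i≤end , _) = gap-increasing (row-bound inv k≤MN) i≤end

  A : List ℚ.ℚ
  A = applyUpTo (fromℤ ∘ value ∘ walk) (suc (M ℕ.* N))

  A-convex : Convex A
  A-convex = convex-applyUpTo (value ∘ walk) (M ℕ.* N) first-gap-positive
    (λ {k} k+1<MN → walk-gap-increasing k (ℕ.<⇒≤ (ℕ.<-trans (ℕ.n<1+n k) k+1<MN)))

  length-A : length A ≡ suc (M ℕ.* N)
  length-A = List.length-applyUpTo (fromℤ ∘ value ∘ walk) (suc (M ℕ.* N))

  X-increasing : ∀ i → X (+ i) ℤ.< X (+ suc i)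
  X-increasing i =
    <-from-balance (Kᵥ :* (con 2 :* eᵥ)) (Kᵥ :* (con 2 :* Dᵥ) :+ (Kᵥ :* (con 2 :* iᵥ :+ con 1) :+ (con 1 :+ con 2 :* iᵥ)))
      (K ∷ e ∷ D ∷ i ∷ []) (identity (+ K) (+ e) (+ D) (+ i))
      (ℕ.≤-<-trans (ℕ.*-monoʳ-≤ K (ℕ.*-monoʳ-≤ 2 e≤D))
                   (ℕ.m<m+n (K ℕ.* (2 ℕ.* D)) (ℕ.<-≤-trans (s≤s z≤n) (ℕ.m≤n+m (suc (2 ℕ.* i)) _))))
    where
    Kᵥ eᵥ Dᵥ iᵥ : Poly 4
    Kᵥ = var (# 0); eᵥ = var (# 1); Dᵥ = var (# 2); iᵥ = var (# 3)
    identity : ∀ K e D i →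
      let X : ℤ → ℤ
          X x = K * (x * x + + 2 * (D - e) * x) + x * x
      in X i + (K * (+ 2 * D) + (K * (+ 2 * i + + 1) + (+ 1 + + 2 * i))) ≡ X (+ 1 + i) + K * (+ 2 * e)
    identity = solve-∀

  Y-increasing : ∀ {j} → j < Q → Y (+ j) ℤ.< Y (+ suc j)
  Y-increasing {j} j<Q =
    <-from-balance (Kᵥ :* (con 2 :* jᵥ :+ con 1)) (Kᵥ :* (con 2 :* (Dᵥ :+ eᵥ)) :+ (con 1 :+ con 2 :* jᵥ))
      (K ∷ e ∷ D ∷ j ∷ []) (identity H (+ K) (+ e) (+ D) (+ j))
      (ℕ.≤-<-trans (ℕ.*-monoʳ-≤ K 2j+1≤2[D+e]) (ℕ.m<m+n (K ℕ.* (2 ℕ.* (D ℕ.+ e))) (s≤s z≤n)))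
    where
    Kᵥ eᵥ Dᵥ jᵥ : Poly 4
    Kᵥ = var (# 0); eᵥ = var (# 1); Dᵥ = var (# 2); jᵥ = var (# 3)
    identity : ∀ H K e D j →
      let Y : ℤ → ℤ
          Y y = H + K * (+ 2 * (D + e) * y - y * y) + y * y
      in Y j + (K * (+ 2 * (D + e)) + (+ 1 + + 2 * j)) ≡ Y (+ 1 + j) + K * (+ 2 * j + + 1)
    identity = solve-∀
    2j+1≤2[D+e] : 2 ℕ.* j ℕ.+ 1 ≤ 2 ℕ.* (D ℕ.+ e)
    2j+1≤2[D+e] = begin
      2 ℕ.* j ℕ.+ 1    ≡⟨ ℕ.+-comm (2 ℕ.* j) 1 ⟩
      1 ℕ.+ 2 ℕ.* j    ≤⟨ ℕ.n≤1+n _ ⟩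
      2 ℕ.+ 2 ℕ.* j    ≡⟨ sym (ℕ.*-suc 2 j) ⟩
      2 ℕ.* suc j      ≤⟨ ℕ.*-monoʳ-≤ 2 (ℕ.≤-trans j<Q (ℕ.+-monoˡ-≤ e (ℕ.≤-trans 2N≤e e≤D))) ⟩
      2 ℕ.* (D ℕ.+ e)  ∎
      where open ℕ.≤-Reasoning

  X<Y₀ : X (+ P) ℤ.< Y (+ 0)
  X<Y₀ = subst (X (+ P) ℤ.<_) (sym (identity H (+ K) (+ D) (+ e))) (ℤ.suc[i]≤j⇒i<j ℤ.≤-refl)
    where
    identity : ∀ H K D e → H + K * (+ 2 * (D + e) * + 0 - + 0 * + 0) + + 0 * + 0 ≡ H
    identity = solve-∀

  B : List ℚ.ℚ
  B = applyUpTo (fromℤ ∘ X ∘ +_) (suc P) ++ applyUpTo (fromℤ ∘ Y ∘ +_) (suc Q)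

  B-increasing : Linked ℚ._<_ B
  B-increasing = Linked.++⁺
    (Linked.applyUpTo⁺₁ (fromℤ ∘ X ∘ +_) (suc P) (λ {i} _ → fromℤ-mono-< (X-increasing i)))
    (subst (λ x → Connected ℚ._<_ x (just (fromℤ (Y (+ 0))))) (sym (last-applyUpTo (fromℤ ∘ X ∘ +_) P))
           (just (fromℤ-mono-< X<Y₀)))
    (Linked.applyUpTo⁺₁ (fromℤ ∘ Y ∘ +_) (suc Q) (λ j+1≤Q → fromℤ-mono-< (Y-increasing (ℕ.≤-pred j+1≤Q))))

  B-unique : Unique B
  B-unique = AllPairs.map ℚ.<⇒≢ (Linked.Linked⇒AllPairs ℚ.<-trans B-increasing)

  length-B : length B ≡ suc P ℕ.+ suc Q
  length-B = trans (List.length-++ (applyUpTo (fromℤ ∘ X ∘ +_) (suc P)))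
                   (cong₂ ℕ._+_ (List.length-applyUpTo (fromℤ ∘ X ∘ +_) (suc P))
                                (List.length-applyUpTo (fromℤ ∘ Y ∘ +_) (suc Q)))

  value∈B+B : ∀ {k d i} → Invariant k (d , i) → k ≤ M ℕ.* N → fromℤ (value (d , i)) ∈SumSet B
  value∈B+B {k} {d} {i} inv@(e<i , i≤end , _) k≤MN =
    fromℤ (X (+ i)) , fromℤ (Y (+ j)) ,
    ∈-++⁺ˡ (∈-applyUpTo⁺ (fromℤ ∘ X ∘ +_) (s≤s i≤P)) ,
    ∈-++⁺ʳ (applyUpTo (fromℤ ∘ X ∘ +_) (suc P)) (∈-applyUpTo⁺ (fromℤ ∘ Y ∘ +_) (s≤s j≤Q)) ,
    trans (cong (λ y → fromℤ (X (+ i) + Y y)) (sym (pos-∸ i≤σ+[e+e]))) (fromℤ-homo-+ (X (+ i)) (Y (+ j)))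
    where
    open ℕ.≤-Reasoning
    d≤M : d ≤ M
    d≤M = row-bound inv k≤MN
    j : ℕ
    j = σ d ℕ.+ (e ℕ.+ e) ℕ.∸ i
    i≤σ+e+e : i ≤ σ d ℕ.+ e ℕ.+ e
    i≤σ+e+e = ℕ.≤-trans i≤end (ℕ.≤-trans (rowEnd≤σ+e+q d) (ℕ.+-monoʳ-≤ (σ d ℕ.+ e) (quotient-small d)))
    i≤σ+[e+e] : i ≤ σ d ℕ.+ (e ℕ.+ e)
    i≤σ+[e+e] = ℕ.≤-trans i≤σ+e+e (ℕ.≤-reflexive (ℕ.+-assoc (σ d) e e))
    i≤P : i ≤ P
    i≤P = ℕ.≤-trans i≤σ+e+e (ℕ.+-monoˡ-≤ e (ℕ.+-monoˡ-≤ e (σ≤N+N (ℕ.m≤n⇒m≤1+n d≤M))))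
    j≤Q : j ≤ Q
    j≤Q = ℕ.m≤n+o⇒m∸n≤o (σ d ℕ.+ (e ℕ.+ e)) i (begin
      σ d ℕ.+ (e ℕ.+ e)        ≤⟨ ℕ.+-monoˡ-≤ (e ℕ.+ e) (σ≤N+N (ℕ.m≤n⇒m≤1+n d≤M)) ⟩
      N ℕ.+ N ℕ.+ (e ℕ.+ e)    ≡⟨ identity (N ℕ.+ N) e ⟩
      e ℕ.+ Q                  ≤⟨ ℕ.+-monoˡ-≤ Q (ℕ.<⇒≤ e<i) ⟩
      i ℕ.+ Q                  ∎)
      where
      identity : ∀ x e → x ℕ.+ (e ℕ.+ e) ≡ e ℕ.+ (x ℕ.+ e)
      identity = solve-∀ℕ

  A⊆B+B : All (_∈SumSet B) A
  A⊆B+B = All.applyUpTo⁺₁ (fromℤ ∘ value ∘ walk) (suc (M ℕ.* N))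
    (λ {k} k<n → value∈B+B (walk-invariant k (ℕ.≤-pred k<n)) (ℕ.≤-pred k<n))

module Instance (m : ℕ) where

  open import Data.Nat using (_≤_; _<_; s≤s)
  open import Data.Nat.DivMod using (m*n/n≡m; /-monoˡ-≤; /-monoʳ-≤)
  open import Data.Nat.Tactic.RingSolver using () renaming (solve-∀ to solve-∀ℕ)

  N e D K : ℕ
  N = suc m
  e = 4 ℕ.* N
  D = e ℕ.* N
  K = suc (4 ℕ.* (e ℕ.* e) ℕ.+ 4 ℕ.* e)

  2N≤e : N ℕ.+ N ≤ e
  2N≤e = ℕ.+-monoʳ-≤ N (ℕ.m≤m+n N _)

  quotient-large : ∀ d → d ≤ N → N ℕ.+ N ≤ D ℕ./ suc (d ℕ.+ m)
  quotient-large d d≤N = ℕ.≤-trans (ℕ.≤-reflexive (sym (m*n/n≡m (N ℕ.+ N) (suc (d ℕ.+ m)))))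
    (/-monoˡ-≤ (suc (d ℕ.+ m)) (ℕ.≤-trans (ℕ.*-monoʳ-≤ (N ℕ.+ N) suc[d+m]≤N+N) (ℕ.≤-reflexive (identity N))))
    where
    suc[d+m]≤N+N : suc (d ℕ.+ m) ≤ N ℕ.+ N
    suc[d+m]≤N+N = ℕ.≤-trans (s≤s (ℕ.+-monoˡ-≤ m d≤N)) (ℕ.≤-reflexive (sym (ℕ.+-suc N m)))
    identity : ∀ N → (N ℕ.+ N) ℕ.* (N ℕ.+ N) ≡ 4 ℕ.* N ℕ.* N
    identity = solve-∀ℕ

  quotient-small : ∀ d → D ℕ./ suc (d ℕ.+ m) ≤ e
  quotient-small d = ℕ.≤-trans (/-monoʳ-≤ D (s≤s (ℕ.m≤n+m m d))) (ℕ.≤-reflexive (m*n/n≡m e N))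

  open Construction m e D K 2N≤e (ℕ.m≤m*n e N) (ℕ.n<1+n _) quotient-large quotient-small
    public hiding (N)

  m<|B| : m < length B
  m<|B| = subst (m <_) (sym length-B) (ℕ.≤-trans (ℕ.m≤m+n N _) (ℕ.≤-trans (ℕ.m≤m+n _ e)
    (ℕ.≤-trans (ℕ.m≤m+n _ e) (ℕ.≤-trans (ℕ.n≤1+n _) (ℕ.m≤m+n _ (suc Q))))))

  |B|²≤1024|A| : length B ℕ.* length B ≤ 1024 ℕ.* length A
  |B|²≤1024|A| = subst₂ (λ b a → b ℕ.* b ≤ 1024 ℕ.* a) (sym length-B) (sym length-A)
    (ℕ.≤-trans (ℕ.m≤m+n (L ℕ.* L) _) (ℕ.≤-reflexive (sym (identity m))))
    where
    L : ℕ
    L = suc P ℕ.+ suc Q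
    identity : ∀ m → let N = suc m; e = 4 ℕ.* N; L = suc (N ℕ.+ N ℕ.+ e ℕ.+ e) ℕ.+ suc (N ℕ.+ N ℕ.+ e)
                     in 1024 ℕ.* suc (m ℕ.* N) ≡ L ℕ.* L ℕ.+ (768 ℕ.* (m ℕ.* m) ℕ.+ 448 ℕ.* m ℕ.+ 700)
    identity = solve-∀ℕ

open import Data.Nat using (ℕ) renaming (_<_ to _<ℕ_)
open import Data.Rational using (ℚ; 0ℚ; _<_; _≤_; _*_)
open import Data.List using (List; length)
open import Data.List.Relation.Unary.All using (All)
open import Data.List.Relation.Unary.Unique.Propositional using (Unique)
open import Data.Product using (_×_; ∃-syntax)

theorem1 : ∃[ c ] (0ℚ < c × ((m : ℕ) → ∃[ B ] (Unique B × m <ℕ length B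
               × ∃[ A ] (Convex A × All (λ a → a ∈SumSet B) A
                 × c * (ℕtoℚ (length B) * ℕtoℚ (length B)) ≤ ℕtoℚ (length A)))))
theorem1 = c , ℚ.*<* (ℤ.+<+ ℕ.z<s) , λ m → let open Instance m in
  B , B-unique , m<|B| , A , A-convex , A⊆B+B , x²≤ky⇒cx²≤y c 1024 (length B) (length A) refl |B|²≤1024|A|
  where
  c : ℚ
  c = + 1 ℚ./ 1024
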